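{- Let $T$ be a rooted tree with vertex set $[n]$ and $s \in [n]^n$. Then $(T,s)$ is a parking function if and only if for all $v \in [n]$ we have $|T_v| \leq |\{i : s_i \in V(T_v)\}|$.
   Context: A rooted tree $T$ on vertex set $[n]$ has all its edges oriented towards the root. Given $s=(s_1,\dots,s_n)\in[n]^n$, drivers $1,\dots,n$ arrive in order; driver $i$ goes to vertex $s_i$ and parks there if it is unoccupied; otherwise she travels along the unique directed path from $s_i$ towards the root and parks at the first unoccupied vertex; if there is none, she leaves without parking. $(T,s)$ is a parking function if all $n$ drivers park. For $v\in[n]$, $T_v$ is the subtree induced by the vertices $u$ having a directed path (possibly of length $0$) from $u$ to $v$. -}

module Defs where

open import Data.Nat using (ℕ; zero; suc)
open import Data.Fin using (Fin)
open import Data.Fin.Properties using (any?) renaming (_≟_ to _≟ᶠ_)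
open import Data.Maybe using (Maybe; just; nothing; _>>=_)
open import Data.Maybe.Properties using (≡-dec)
open import Data.Bool using (Bool; true; false)
open import Data.Product using (Σ; ∃; _×_; _,_)
open import Data.List using (List; []; _∷_; length; filter)
open import Data.Vec using (Vec; toList; allFin)
open import Relation.Binary.PropositionalEquality using (_≡_)
open import Relation.Nullary using (Dec)
open import Relation.Unary using (Decidable)

-- A rooted tree on vertex set Fin n (= [n]), edges oriented towards the root,
-- given by its parent map: parent v = just w iff (v → w) is an edge,
-- parent v = nothing iff v is the root.
step : ∀ {n} → (Fin n → Maybe (Fin n)) → Maybe (Fin n) → Maybe (Fin n)
step parent x = x >>= parent

iter : ∀ {n} → (Fin n → Maybe (Fin n)) → ℕ → Maybe (Fin n) → Maybe (Fin n)
iter parent zero    x = x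
iter parent (suc k) x = step parent (iter parent k x)

record RootedTree (n : ℕ) : Set where
  field
    parent   : Fin n → Maybe (Fin n)
    root     : Fin n
    root-top : parent root ≡ nothing
    root-uniq : ∀ v → parent v ≡ nothing → v ≡ root
    -- acyclic: from every vertex, following edges eventually leaves the tree
    -- (i.e. reaches the root and stops)
    acyclic  : ∀ v → ∃ λ k → iter parent k (just v) ≡ nothing
open RootedTree public

-- u ∈ V(T_v): there is a directed path (possibly of length 0) from u to v.
-- In a tree on n vertices such a path has length < n, so k ranges over Fin n.
InSubtree : ∀ {n} → RootedTree n → Fin n → Fin n → Set
InSubtree {n} T v u = ∃ λ (k : Fin n) → iter (parent T) (Data.Fin.toℕ k) (just u) ≡ just v

inSubtree? : ∀ {n} (T : RootedTree n) (v : Fin n) → Decidable (InSubtree T v)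
inSubtree? {n} T v u = any? λ k → ≡-dec _≟ᶠ_ (iter (parent T) (Data.Fin.toℕ k) (just u)) (just v)

subtreeSize : ∀ {n} → RootedTree n → Fin n → ℕ
subtreeSize {n} T v = length (filter (inSubtree? T v) (toList (allFin n)))

preferenceCount : ∀ {n} → RootedTree n → Vec (Fin n) n → Fin n → ℕ
preferenceCount T s v = length (filter (inSubtree? T v) (toList s))

Occ : ℕ → Set
Occ n = Fin n → Bool

occupy : ∀ {n} → Occ n → Fin n → Occ n
occupy occ w u with u ≟ᶠ w
... | Relation.Nullary.yes _ = true
... | Relation.Nullary.no  _ = occ u

data ParksAt {n} (T : RootedTree n) (occ : Occ n) : Fin n → Fin n → Set where
  here  : ∀ {v} → occ v ≡ false → ParksAt T occ v v
  there : ∀ {v u w} → occ v ≡ true → parent T v ≡ just u →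
          ParksAt T occ u w → ParksAt T occ v w

data AllPark {n} (T : RootedTree n) : Occ n → List (Fin n) → Set where
  done : ∀ {occ} → AllPark T occ []
  park : ∀ {occ v w ss} → ParksAt T occ v w →
         AllPark T (occupy occ w) ss → AllPark T occ (v ∷ ss)

IsParkingFunction : ∀ {n} → RootedTree n → Vec (Fin n) n → Set
IsParkingFunction T s = AllPark T (λ _ → false) (toList s)

module Submission where

-- Let e(v) be the number of vacant vertices of T_v and d(v) the number of drivers still to come who
-- prefer a vertex of T_v. Drivers only move towards the root, so a driver parking in T_v prefers
-- T_v; since all n vertices end up filled, |T_v| ≤ d(v) is necessary. Conversely, e ≤ d everywhere
-- is preserved by every arrival. The vertex set of T_v is v together with the subtrees of the children
-- of v, so along a fully occupied path from the preferred vertex s of the arriving driver, the strict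
-- inequality e < d (which holds at s because of the driver herself) propagates upwards. Hence she
-- cannot pass a vertex v with e(v) = d(v) without parking below it, and she cannot pass the root.

open import Defs
open import Data.Nat using (ℕ; _≤_)
open import Data.Fin using (Fin)
open import Data.Vec using (Vec)
open import Function.Bundles using (_⇔_)

open import Data.Nat using (zero; suc; _+_; _*_; _∸_; _<_; _<?_; z≤n)
open import Data.Nat.Properties
open import Data.Fin using (zero; suc; toℕ; fromℕ<; punchIn)
open import Data.Fin.Properties using (pigeonhole; toℕ-fromℕ<; toℕ<n; punchInᵢ≢i) renaming (_≟_ to _≟ᶠ_)
open import Data.Maybe using (Maybe; just; nothing; fromMaybe)
open import Data.Maybe.Properties using (just-injective; ≡-dec)
open import Data.Bool using (true; false; if_then_else_)
open import Data.Product using (∃; _×_; _,_; proj₁; proj₂)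
open import Data.Sum using (_⊎_; inj₁; inj₂)
open import Data.List using (List; []; _∷_; length; filter)
open import Data.Vec using (toList; tabulate)
open import Data.Vec.Properties using (length-toList)
open import Data.Vec.Functional using (removeAt)
open import Function using (_∘_; id)
open import Function.Bundles using (mk⇔; Equivalence)
open import Relation.Unary using (Decidable)
open import Relation.Nullary using (Dec; yes; no; ¬_)
import Relation.Nullary.Decidable as Dec
open import Relation.Nullary.Negation using (contradiction)
open import Relation.Binary.PropositionalEquality
open import Relation.Binary.Construct.Closure.ReflexiveTransitive using (Star; ε; _◅_; _◅◅_)
open import Algebra.Properties.Semiring.Sum +-*-semiring
  using (sum; sum-syntax; sum-remove; sum-cong-≗; sum-replicate-zero; ∑-distrib-+; ∑-comm; *-distribˡ-sum; *-distribʳ-sum)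

𝟙 : ∀ {p} {P : Set p} → Dec P → ℕ
𝟙 (yes _) = 1
𝟙 (no _)  = 0

module _ {p} {P : Set p} where

  𝟙-yes : (d : Dec P) → P → 𝟙 d ≡ 1
  𝟙-yes (yes _) _  = refl
  𝟙-yes (no ¬p) p  = contradiction p ¬p

  𝟙-no : (d : Dec P) → ¬ P → 𝟙 d ≡ 0
  𝟙-no (yes p) ¬p = contradiction p ¬p
  𝟙-no (no _)  _  = refl

  𝟙≤1 : (d : Dec P) → 𝟙 d ≤ 1
  𝟙≤1 (yes _) = ≤-refl
  𝟙≤1 (no _)  = z≤n

∑-mono-≤ : ∀ {n} {f g : Fin n → ℕ} → (∀ i → f i ≤ g i) → sum f ≤ sum g
∑-mono-≤ {zero}  f≤g = z≤n
∑-mono-≤ {suc n} f≤g = +-mono-≤ (f≤g zero) (∑-mono-≤ (λ i → f≤g (suc i)))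

∑-mono-< : ∀ {n} {f g : Fin n → ℕ} (j : Fin n) → (∀ i → f i ≤ g i) → f j < g j → sum f < sum g
∑-mono-< {suc n} {f} {g} j f≤g fj<gj = begin-strict
  sum f                         ≡⟨ sum-remove {i = j} f ⟩
  f j + sum (removeAt f j)      <⟨ +-mono-<-≤ fj<gj (∑-mono-≤ (λ i → f≤g (punchIn j i))) ⟩
  g j + sum (removeAt g j)      ≡⟨ sum-remove {i = j} g ⟨
  sum g                         ∎
  where open ≤-Reasoning

∑-zero : ∀ {n} {f : Fin n → ℕ} → (∀ i → f i ≡ 0) → sum f ≡ 0
∑-zero {n} f≡0 = trans (sum-cong-≗ f≡0) (sum-replicate-zero n)

∑-single : ∀ {n} {f : Fin n → ℕ} (j : Fin n) → (∀ i → i ≢ j → f i ≡ 0) → sum f ≡ f j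
∑-single {suc n} {f} j f≡0 = begin
  sum f                     ≡⟨ sum-remove {i = j} f ⟩
  f j + sum (removeAt f j)  ≡⟨ cong (f j +_) (∑-zero (λ i → f≡0 (punchIn j i) (punchInᵢ≢i j i))) ⟩
  f j + 0                   ≡⟨ +-identityʳ (f j) ⟩
  f j                       ∎
  where open ≡-Reasoning

∑-pick : ∀ {n} (f : Fin n → ℕ) j → ∑[ i < n ] (𝟙 (i ≟ᶠ j) * f i) ≡ f j
∑-pick f j = trans (∑-single j (λ i i≢j → cong (_* f i) (𝟙-no (i ≟ᶠ j) i≢j)))
                   (trans (cong (_* f j) (𝟙-yes (j ≟ᶠ j) refl)) (*-identityˡ (f j)))

∑-insert : ∀ {n} j (f : Fin n → ℕ) → ∑[ i < n ] (𝟙 (i ≟ᶠ j) + f i) ≡ suc (sum f)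
∑-insert {n} j f = trans (∑-distrib-+ (λ i → 𝟙 (i ≟ᶠ j)) f)
                     (cong (_+ sum f) (trans (sum-cong-≗ {n} (λ i → sym (*-identityʳ _))) (∑-pick (λ _ → 1) j)))

length-filter-tabulate : ∀ {a p m} {A : Set a} {P : A → Set p} (P? : Decidable P) (f : Fin m → A) →
                         length (filter P? (toList (tabulate f))) ≡ ∑[ i < m ] 𝟙 (P? (f i))
length-filter-tabulate {m = zero}  P? f = refl
length-filter-tabulate {m = suc m} P? f with P? (f zero)
... | yes _ = cong suc (length-filter-tabulate P? (f ∘ suc))
... | no  _ = length-filter-tabulate P? (f ∘ suc)

∑-ones : ∀ n → ∑[ i < n ] 1 ≡ n
∑-ones zero    = refl
∑-ones (suc n) = cong suc (∑-ones n)

vacant : ∀ {n} → Occ n → Fin n → ℕ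
vacant occ u = if occ u then 0 else 1

vacant-occupy : ∀ {n} {occ : Occ n} {w} → occ w ≡ false →
                ∀ u → vacant occ u ≡ 𝟙 (u ≟ᶠ w) + vacant (occupy occ w) u
vacant-occupy {w = w} ow u with u ≟ᶠ w
... | yes refl = cong (λ b → if b then 0 else 1) ow
... | no  _    = refl

∑-vacant-occupy : ∀ {n} {occ : Occ n} {w} → occ w ≡ false →
                  sum (vacant occ) ≡ suc (sum (vacant (occupy occ w)))
∑-vacant-occupy {n} {w = w} ow = trans (sum-cong-≗ {n} (vacant-occupy ow)) (∑-insert w _)

multiplicity : ∀ {n} → List (Fin n) → Fin n → ℕ
multiplicity []       _ = 0
multiplicity (x ∷ xs) u = 𝟙 (u ≟ᶠ x) + multiplicity xs u

∑-multiplicity : ∀ {n} (xs : List (Fin n)) → sum (multiplicity xs) ≡ length xs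
∑-multiplicity {n} []   = ∑-zero {n} (λ _ → refl)
∑-multiplicity (x ∷ xs) = trans (∑-insert x (multiplicity xs)) (cong suc (∑-multiplicity xs))

module _ {n} (f : Fin n → Maybe (Fin n)) where

  Halting : Set
  Halting = ∀ x → ∃ λ k → iter f k (just x) ≡ nothing

  iter-nothing : ∀ k → iter f k nothing ≡ nothing
  iter-nothing zero    = refl
  iter-nothing (suc k) = cong (step f) (iter-nothing k)

  iter-+ : ∀ j k x → iter f (j + k) x ≡ iter f j (iter f k x)
  iter-+ zero    k x = refl
  iter-+ (suc j) k x = cong (step f) (iter-+ j k x)

  iter-suc : ∀ k x → iter f (suc k) (just x) ≡ iter f k (f x)
  iter-suc k x = trans (cong (λ j → iter f j (just x)) (+-comm 1 k)) (iter-+ k 1 (just x))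

  iter-periodic : ∀ {p z} → iter f p (just z) ≡ just z → ∀ t → iter f (t * p) (just z) ≡ just z
  iter-periodic         fix zero    = refl
  iter-periodic {p} {z} fix (suc t) = begin
    iter f (p + t * p) (just z)      ≡⟨ iter-+ p (t * p) (just z) ⟩
    iter f p (iter f (t * p) (just z)) ≡⟨ cong (iter f p) (iter-periodic fix t) ⟩
    iter f p (just z)                ≡⟨ fix ⟩
    just z                           ∎
    where open ≡-Reasoning

  iter-defined : ∀ {i k u v} → i ≤ k → iter f k (just u) ≡ just v → ∃ λ z → iter f i (just u) ≡ just z
  iter-defined {i} {k} {u} i≤k fᵏu with iter f i (just u) in fᶦu
  ... | just z  = z , refl
  ... | nothing = contradiction (begin
    just _                                   ≡⟨ fᵏu ⟨
    iter f k (just u)                        ≡⟨ cong (λ j → iter f j (just u)) (m∸n+n≡m i≤k) ⟨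
    iter f (k ∸ i + i) (just u)              ≡⟨ iter-+ (k ∸ i) i (just u) ⟩
    iter f (k ∸ i) (iter f i (just u))       ≡⟨ cong (iter f (k ∸ i)) fᶦu ⟩
    iter f (k ∸ i) nothing                   ≡⟨ iter-nothing (k ∸ i) ⟩
    nothing                                  ∎) λ ()
    where open ≡-Reasoning

  module _ (halting : Halting) where

    -- after the halting time k, the orbit of z would be back at z at time k * (d + 1)
    no-periodic-point : ∀ z d → iter f (suc d) (just z) ≢ just z
    no-periodic-point z d fix with halting z
    ... | k , halt = contradiction (begin
      just z                          ≡⟨ iter-periodic fix k ⟨
      iter f (k * suc d) (just z)     ≡⟨ cong (λ j → iter f j (just z)) (trans (*-suc k d) (+-comm k (k * d))) ⟩
      iter f (k * d + k) (just z)     ≡⟨ iter-+ (k * d) k (just z) ⟩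
      iter f (k * d) (iter f k (just z)) ≡⟨ cong (iter f (k * d)) halt ⟩
      iter f (k * d) nothing          ≡⟨ iter-nothing (k * d) ⟩
      nothing                         ∎) λ ()
      where open ≡-Reasoning

    iter-injective : ∀ {i j u z} → i < j → iter f i (just u) ≡ just z → iter f j (just u) ≢ just z
    iter-injective {i} {j} {u} {z} i<j fᶦu fʲu with m≤n⇒∃[o]m+o≡n i<j
    ... | d , 1+i+d≡j = no-periodic-point z d (begin
      iter f (suc d) (just z)               ≡⟨ cong (iter f (suc d)) fᶦu ⟨
      iter f (suc d) (iter f i (just u))    ≡⟨ iter-+ (suc d) i (just u) ⟨
      iter f (suc d + i) (just u)           ≡⟨ cong (λ k → iter f k (just u)) (trans (cong suc (+-comm d i)) 1+i+d≡j) ⟩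
      iter f j (just u)                     ≡⟨ fʲu ⟩
      just z                                ∎)
      where open ≡-Reasoning

    -- pigeonhole on the first n + 1 iterates, which are all defined if k ≥ n
    iter-bound : ∀ {k u v} → iter f k (just u) ≡ just v → k < n
    iter-bound {k} {u} fᵏu with k <? n
    ... | yes k<n = k<n
    ... | no k≮n  with pigeonhole (n<1+n n) (λ i → fromMaybe u (iter f (toℕ i) (just u)))
    ...   | i , j , i<j , same with defined i | defined j
      where
        defined : ∀ (i : Fin (suc n)) → ∃ λ z → iter f (toℕ i) (just u) ≡ just z
        defined i = iter-defined (≤-trans (≤-pred (toℕ<n i)) (≮⇒≥ k≮n)) fᵏu
    ...     | zᵢ , fᶦu | zⱼ , fʲu = contradiction (trans fʲu (cong just zⱼ≡zᵢ)) (iter-injective i<j fᶦu)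
      where
        zⱼ≡zᵢ : zⱼ ≡ zᵢ
        zⱼ≡zᵢ = trans (cong (fromMaybe u) (sym fʲu)) (trans (sym same) (cong (fromMaybe u) fᶦu))

module _ {n} (T : RootedTree n) where

  infix 4 _⟶_ _⇝_

  _⟶_ : Fin n → Fin n → Set
  u ⟶ w = parent T u ≡ just w

  _⇝_ : Fin n → Fin n → Set
  _⇝_ = Star _⟶_

  ⇝⇒iter : ∀ {u v} → u ⇝ v → ∃ λ k → iter (parent T) k (just u) ≡ just v
  ⇝⇒iter ε = 0 , refl
  ⇝⇒iter {u} (u⟶w ◅ w⇝v) with ⇝⇒iter w⇝v
  ... | k , fᵏw = suc k , trans (iter-suc (parent T) k u) (trans (cong (iter (parent T) k) u⟶w) fᵏw)

  iter⇒⇝ : ∀ k {u v} → iter (parent T) k (just u) ≡ just v → u ⇝ v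
  iter⇒⇝ zero    {u} fᵏu = subst (u ⇝_) (just-injective fᵏu) ε
  iter⇒⇝ (suc k) {u} fᵏu with parent T u in u⟶ | trans (sym (iter-suc (parent T) k u)) fᵏu
  ... | nothing | fᵏ⁻¹nothing = contradiction (trans (sym fᵏ⁻¹nothing) (iter-nothing (parent T) k)) λ ()
  ... | just w  | fᵏ⁻¹w       = u⟶ ◅ iter⇒⇝ k fᵏ⁻¹w

  InSubtree⇔⇝ : ∀ {u v} → InSubtree T v u ⇔ u ⇝ v
  InSubtree⇔⇝ {u} = mk⇔ (λ (k , fᵏu) → iter⇒⇝ (toℕ k) fᵏu) from
    where
      from : ∀ {v} → u ⇝ v → InSubtree T v u
      from u⇝v with ⇝⇒iter u⇝v
      ... | k , fᵏu = fromℕ< k<n , trans (cong (λ j → iter (parent T) j (just u)) (toℕ-fromℕ< k<n)) fᵏu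
        where
          k<n : k < n
          k<n = iter-bound (parent T) (acyclic T) fᵏu

  _⟶?_ : ∀ u w → Dec (u ⟶ w)
  u ⟶? w = ≡-dec _≟ᶠ_ (parent T u) (just w)

  _⇝?_ : ∀ u v → Dec (u ⇝ v)
  u ⇝? v = Dec.map InSubtree⇔⇝ (inSubtree? T v u)

  no-cycle : ∀ {u w} → u ⟶ w → ¬ w ⇝ u
  no-cycle {u} {w} u⟶w w⇝u with ⇝⇒iter w⇝u
  ... | k , fᵏw = no-periodic-point (parent T) (acyclic T) u k
                    (trans (iter-suc (parent T) k u) (trans (cong (iter (parent T) k) u⟶w) fᵏw))

  ⇝-linear : ∀ {u a b} → u ⇝ a → u ⇝ b → a ⇝ b ⊎ b ⇝ a
  ⇝-linear ε             u⇝b           = inj₁ u⇝b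
  ⇝-linear u⇝a           ε             = inj₂ u⇝a
  ⇝-linear (u⟶x ◅ x⇝a) (u⟶y ◅ y⇝b) with just-injective (trans (sym u⟶x) u⟶y)
  ... | refl = ⇝-linear x⇝a y⇝b

  ⇝-last-edge : ∀ {u w v} → u ⟶ w → w ⇝ v → ∃ λ c → u ⇝ c × c ⟶ v
  ⇝-last-edge {u} u⟶w ε = u , ε , u⟶w
  ⇝-last-edge u⟶w (w⟶x ◅ x⇝v) with ⇝-last-edge w⟶x x⇝v
  ... | c , w⇝c , c⟶v = c , u⟶w ◅ w⇝c , c⟶v

  child-unique : ∀ {u c c′ v} → u ⇝ c → c ⟶ v → u ⇝ c′ → c′ ⟶ v → c ≡ c′
  child-unique u⇝c c⟶v u⇝c′ c′⟶v with ⇝-linear u⇝c u⇝c′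
  ... | inj₁ ε = refl
  ... | inj₂ ε = refl
  ... | inj₁ (c⟶x ◅ x⇝c′) with just-injective (trans (sym c⟶x) c⟶v)
  ...   | refl = contradiction x⇝c′ (no-cycle c′⟶v)
  child-unique u⇝c c⟶v u⇝c′ c′⟶v | inj₂ (c′⟶x ◅ x⇝c) with just-injective (trans (sym c′⟶x) c′⟶v)
  ...   | refl = contradiction x⇝c (no-cycle c⟶v)

  ⇝-root : ∀ u → u ⇝ root T
  ⇝-root u = go (proj₁ (acyclic T u)) u (proj₂ (acyclic T u))
    where
      go : ∀ k u → iter (parent T) k (just u) ≡ nothing → u ⇝ root T
      go zero    u ()
      go (suc k) u halt with parent T u in u⟶ | trans (sym (iter-suc (parent T) k u)) halt
      ... | nothing | _     = subst (u ⇝_) (root-uniq T u u⟶) ε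
      ... | just w  | haltʷ = u⟶ ◅ go k w haltʷ

  member : Fin n → Fin n → ℕ
  member v u = 𝟙 (inSubtree? T v u)

  edge : Fin n → Fin n → ℕ
  edge c v = 𝟙 (c ⟶? v)

  member-yes : ∀ {u v} → u ⇝ v → member v u ≡ 1
  member-yes {u} {v} u⇝v = 𝟙-yes (inSubtree? T v u) (Equivalence.from InSubtree⇔⇝ u⇝v)

  member-no : ∀ {u v} → ¬ u ⇝ v → member v u ≡ 0
  member-no {u} {v} u⇝̸v = 𝟙-no (inSubtree? T v u) (u⇝̸v ∘ Equivalence.to InSubtree⇔⇝)

  edge*member-yes : ∀ {u c v} → c ⟶ v → u ⇝ c → edge c v * member c u ≡ 1
  edge*member-yes {c = c} {v} c⟶v u⇝c = cong₂ _*_ (𝟙-yes (c ⟶? v) c⟶v) (member-yes u⇝c)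

  edge*member-no : ∀ {u c v} → ¬ (c ⟶ v × u ⇝ c) → edge c v * member c u ≡ 0
  edge*member-no {u} {c} {v} neither with c ⟶? v
  ... | yes c⟶v = cong (1 *_) (member-no (λ u⇝c → neither (c⟶v , u⇝c)))
  ... | no  _   = refl

  member-decomposition : ∀ v u → member v u ≡ 𝟙 (u ≟ᶠ v) + ∑[ c < n ] (edge c v * member c u)
  member-decomposition v u with u ≟ᶠ v
  ... | yes refl = begin
    member u u                          ≡⟨ member-yes ε ⟩
    1                                   ≡⟨ cong suc (∑-zero {n} (λ c → edge*member-no (λ (c⟶u , u⇝c) → no-cycle c⟶u u⇝c))) ⟨
    1 + ∑[ c < n ] (edge c u * member c u) ∎
    where open ≡-Reasoning
  ... | no u≢v with u ⇝? v
  ...   | no u⇝̸v = trans (member-no u⇝̸v)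
                      (sym (∑-zero {n} (λ c → edge*member-no (λ (c⟶v , u⇝c) → u⇝̸v (u⇝c ◅◅ c⟶v ◅ ε)))))
  ...   | yes ε = contradiction refl u≢v
  ...   | yes (u⟶w ◅ w⇝v) with ⇝-last-edge u⟶w w⇝v
  ...     | c₀ , u⇝c₀ , c₀⟶v = begin
    member v u                            ≡⟨ member-yes (u⟶w ◅ w⇝v) ⟩
    1                                     ≡⟨ edge*member-yes c₀⟶v u⇝c₀ ⟨
    edge c₀ v * member c₀ u               ≡⟨ ∑-single c₀ (λ c c≢c₀ → edge*member-no
                                               (λ (c⟶v , u⇝c) → c≢c₀ (child-unique u⇝c c⟶v u⇝c₀ c₀⟶v))) ⟨
    ∑[ c < n ] (edge c v * member c u)      ∎
    where open ≡-Reasoning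

  subtreeSum : Fin n → (Fin n → ℕ) → ℕ
  subtreeSum v w = ∑[ u < n ] (member v u * w u)

  subtreeSum-decomposition : ∀ v w → subtreeSum v w ≡ w v + ∑[ c < n ] (edge c v * subtreeSum c w)
  subtreeSum-decomposition v w = begin
    ∑[ u < n ] (member v u * w u)
      ≡⟨ sum-cong-≗ (λ u → trans (cong (_* w u) (member-decomposition v u)) (distribute u)) ⟩
    ∑[ u < n ] (𝟙 (u ≟ᶠ v) * w u + ∑[ c < n ] (edge c v * (member c u * w u)))
      ≡⟨ ∑-distrib-+ (λ u → 𝟙 (u ≟ᶠ v) * w u) _ ⟩
    ∑[ u < n ] (𝟙 (u ≟ᶠ v) * w u) + ∑[ u < n ] ∑[ c < n ] (edge c v * (member c u * w u))
      ≡⟨ cong₂ _+_ (∑-pick w v) (∑-comm (λ u c → edge c v * (member c u * w u))) ⟩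
    w v + ∑[ c < n ] ∑[ u < n ] (edge c v * (member c u * w u))
      ≡⟨ cong (w v +_) (sum-cong-≗ (λ c → *-distribˡ-sum (edge c v) (λ u → member c u * w u))) ⟨
    w v + ∑[ c < n ] (edge c v * subtreeSum c w)
      ∎
    where
      open ≡-Reasoning
      distribute : ∀ u → (𝟙 (u ≟ᶠ v) + ∑[ c < n ] (edge c v * member c u)) * w u
                       ≡ 𝟙 (u ≟ᶠ v) * w u + ∑[ c < n ] (edge c v * (member c u * w u))
      distribute u = begin
        (𝟙 (u ≟ᶠ v) + ∑[ c < n ] (edge c v * member c u)) * w u
          ≡⟨ *-distribʳ-+ (w u) (𝟙 (u ≟ᶠ v)) _ ⟩
        𝟙 (u ≟ᶠ v) * w u + ∑[ c < n ] (edge c v * member c u) * w u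
          ≡⟨ cong (𝟙 (u ≟ᶠ v) * w u +_) (*-distribʳ-sum (w u) (λ c → edge c v * member c u)) ⟩
        𝟙 (u ≟ᶠ v) * w u + ∑[ c < n ] (edge c v * member c u * w u)
          ≡⟨ cong (𝟙 (u ≟ᶠ v) * w u +_) (sum-cong-≗ (λ c → *-assoc (edge c v) (member c u) (w u))) ⟩
        𝟙 (u ≟ᶠ v) * w u + ∑[ c < n ] (edge c v * (member c u * w u))
          ∎

  subtreeSum-insert : ∀ v x w → subtreeSum v (λ u → 𝟙 (u ≟ᶠ x) + w u) ≡ member v x + subtreeSum v w
  subtreeSum-insert v x w = begin
    ∑[ u < n ] (member v u * (𝟙 (u ≟ᶠ x) + w u))
      ≡⟨ sum-cong-≗ (λ u → trans (*-distribˡ-+ (member v u) _ _) (cong (_+ member v u * w u) (*-comm (member v u) _))) ⟩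
    ∑[ u < n ] (𝟙 (u ≟ᶠ x) * member v u + member v u * w u)
      ≡⟨ ∑-distrib-+ (λ u → 𝟙 (u ≟ᶠ x) * member v u) _ ⟩
    ∑[ u < n ] (𝟙 (u ≟ᶠ x) * member v u) + subtreeSum v w
      ≡⟨ cong (_+ subtreeSum v w) (∑-pick (member v) x) ⟩
    member v x + subtreeSum v w
      ∎
    where open ≡-Reasoning

  subtreeSum-occupy : ∀ {occ : Occ n} {w} v → occ w ≡ false →
                      subtreeSum v (vacant occ) ≡ member v w + subtreeSum v (vacant (occupy occ w))
  subtreeSum-occupy {w = w} v ow =
    trans (sum-cong-≗ (λ u → cong (member v u *_) (vacant-occupy ow u))) (subtreeSum-insert v w _)

  subtreeSum≤∑ : ∀ v w → subtreeSum v w ≤ sum w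
  subtreeSum≤∑ v w = ∑-mono-≤ (λ u → ≤-trans (*-monoˡ-≤ (w u) (𝟙≤1 (inSubtree? T v u))) (≤-reflexive (+-identityʳ (w u))))

  subtreeSum-root : ∀ w → subtreeSum (root T) w ≡ sum w
  subtreeSum-root w = sum-cong-≗ (λ u → trans (cong (_* w u) (member-yes (⇝-root u))) (+-identityʳ (w u)))

  length-filter-inSubtree : ∀ v xs → length (filter (inSubtree? T v) xs) ≡ subtreeSum v (multiplicity xs)
  length-filter-inSubtree v []       = sym (∑-zero {n} (λ u → *-zeroʳ (member v u)))
  length-filter-inSubtree v (x ∷ xs) rewrite subtreeSum-insert v x (multiplicity xs) with inSubtree? T v x
  ... | yes _ = cong suc (length-filter-inSubtree v xs)
  ... | no  _ = length-filter-inSubtree v xs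

  member-antitone : ∀ {s w} v → s ⇝ w → member v w ≤ member v s
  member-antitone {s} {w} v s⇝w with w ⇝? v
  ... | yes w⇝v = ≤-reflexive (trans (member-yes w⇝v) (sym (member-yes (s⇝w ◅◅ w⇝v))))
  ... | no  w⇝̸v = ≤-trans (≤-reflexive (member-no w⇝̸v)) z≤n

  -- Necessity

  noneOccupied : Occ n
  noneOccupied _ = false

  parksAt-path : ∀ {occ s w} → ParksAt T occ s w → s ⇝ w
  parksAt-path (here _)         = ε
  parksAt-path (there _ s⟶u pk) = s⟶u ◅ parksAt-path pk

  parksAt-vacant : ∀ {occ s w} → ParksAt T occ s w → occ w ≡ false
  parksAt-vacant (here ow)      = ow
  parksAt-vacant (there _ _ pk) = parksAt-vacant pk

  allPark-accounting : ∀ {occ xs} → AllPark T occ xs → ∃ λ final →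
    (∀ v → subtreeSum v (vacant occ) ≤ subtreeSum v (multiplicity xs) + subtreeSum v (vacant final)) ×
    sum (vacant occ) ≡ length xs + sum (vacant final)
  allPark-accounting {occ} done = occ , (λ v → m≤n+m _ _) , refl
  allPark-accounting {occ} (park {v = s} {w} {xs} pk rest) with allPark-accounting rest
  ... | final , bound , total = final , bound′ , trans (∑-vacant-occupy {occ = occ} (parksAt-vacant pk)) (cong suc total)
    where
      bound′ : ∀ v → subtreeSum v (vacant occ) ≤ subtreeSum v (multiplicity (s ∷ xs)) + subtreeSum v (vacant final)
      bound′ v = begin
        subtreeSum v (vacant occ)
          ≡⟨ subtreeSum-occupy v (parksAt-vacant pk) ⟩
        member v w + subtreeSum v (vacant (occupy occ w))
          ≤⟨ +-mono-≤ (member-antitone v (parksAt-path pk)) (bound v) ⟩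
        member v s + (subtreeSum v (multiplicity xs) + subtreeSum v (vacant final))
          ≡⟨ +-assoc (member v s) _ _ ⟨
        member v s + subtreeSum v (multiplicity xs) + subtreeSum v (vacant final)
          ≡⟨ cong (_+ subtreeSum v (vacant final)) (subtreeSum-insert v s (multiplicity xs)) ⟨
        subtreeSum v (multiplicity (s ∷ xs)) + subtreeSum v (vacant final)
          ∎
        where open ≤-Reasoning

  subtreeSize≡subtreeSum : ∀ v → subtreeSize T v ≡ subtreeSum v (vacant noneOccupied)
  subtreeSize≡subtreeSum v =
    trans (length-filter-tabulate (inSubtree? T v) id) (sum-cong-≗ {n} (λ u → sym (*-identityʳ (member v u))))

  preferenceCount≡subtreeSum : ∀ (s : Vec (Fin n) n) v → preferenceCount T s v ≡ subtreeSum v (multiplicity (toList s))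
  preferenceCount≡subtreeSum s v = length-filter-inSubtree v (toList s)

  parking⇒subtree-bound : ∀ (s : Vec (Fin n) n) → IsParkingFunction T s →
                          ∀ v → subtreeSize T v ≤ preferenceCount T s v
  parking⇒subtree-bound s pf v with allPark-accounting pf
  ... | final , bound , total = begin
    subtreeSize T v
      ≡⟨ subtreeSize≡subtreeSum v ⟩
    subtreeSum v (vacant noneOccupied)
      ≤⟨ bound v ⟩
    subtreeSum v (multiplicity (toList s)) + subtreeSum v (vacant final)
      ≤⟨ +-monoʳ-≤ _ (subtreeSum≤∑ v (vacant final)) ⟩
    subtreeSum v (multiplicity (toList s)) + sum (vacant final)
      ≡⟨ cong (subtreeSum v (multiplicity (toList s)) +_) all-filled ⟩
    subtreeSum v (multiplicity (toList s)) + 0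
      ≡⟨ trans (+-identityʳ _) (sym (preferenceCount≡subtreeSum s v)) ⟩
    preferenceCount T s v
      ∎
    where
      open ≤-Reasoning
      all-filled : sum (vacant final) ≡ 0
      all-filled = +-cancelˡ-≡ n _ 0 (begin-equality
        n + sum (vacant final)                  ≡⟨ cong (_+ sum (vacant final)) (length-toList s) ⟨
        length (toList s) + sum (vacant final)  ≡⟨ total ⟨
        sum (vacant noneOccupied)               ≡⟨ ∑-ones n ⟩
        n                                       ≡⟨ +-identityʳ n ⟨
        n + 0                                   ∎)

  -- Sufficiency

  data OccupiedPath (occ : Occ n) : Fin n → Fin n → Set where
    stuck : ∀ {v} → occ v ≡ true → OccupiedPath occ v v
    climb : ∀ {u w v} → occ u ≡ true → u ⟶ w → OccupiedPath occ w v → OccupiedPath occ u v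

  occupiedPath-source : ∀ {occ u v} → OccupiedPath occ u v → occ u ≡ true
  occupiedPath-source (stuck ou)     = ou
  occupiedPath-source (climb ou _ _) = ou

  Balanced : Occ n → List (Fin n) → Set
  Balanced occ xs = ∀ v → subtreeSum v (vacant occ) ≤ subtreeSum v (multiplicity xs)

  edge-yes : ∀ {u w} → u ⟶ w → ∀ a → edge u w * a ≡ a
  edge-yes {u} {w} u⟶w a = trans (cong (_* a) (𝟙-yes (u ⟶? w) u⟶w)) (+-identityʳ a)

  subtreeSum-occupied : ∀ {occ : Occ n} {v} → occ v ≡ true →
                        subtreeSum v (vacant occ) ≡ ∑[ c < n ] (edge c v * subtreeSum c (vacant occ))
  subtreeSum-occupied {occ} {v} ov =
    trans (subtreeSum-decomposition v (vacant occ)) (cong (λ b → (if b then 0 else 1) + children) ov)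
    where
      children : ℕ
      children = ∑[ c < n ] (edge c v * subtreeSum c (vacant occ))

  children≤subtreeSum : ∀ v w → ∑[ c < n ] (edge c v * subtreeSum c w) ≤ subtreeSum v w
  children≤subtreeSum v w = ≤-trans (m≤n+m _ (w v)) (≤-reflexive (sym (subtreeSum-decomposition v w)))

  module _ {occ : Occ n} {xs : List (Fin n)} (balanced : Balanced occ xs) where

    children-balanced : ∀ v → ∑[ c < n ] (edge c v * subtreeSum c (vacant occ))
                              ≤ ∑[ c < n ] (edge c v * subtreeSum c (multiplicity xs))
    children-balanced v = ∑-mono-≤ (λ c → *-monoʳ-≤ (edge c v) (balanced c))

    surplus-up : ∀ {u w} → occ w ≡ true → u ⟶ w →
                 subtreeSum u (vacant occ) < subtreeSum u (multiplicity xs) →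
                 subtreeSum w (vacant occ) < subtreeSum w (multiplicity xs)
    surplus-up {u} {w} ow u⟶w surplusᵘ = begin-strict
      subtreeSum w (vacant occ)                                    ≡⟨ subtreeSum-occupied ow ⟩
      ∑[ c < n ] (edge c w * subtreeSum c (vacant occ))            <⟨ ∑-mono-< u (λ c → *-monoʳ-≤ (edge c w) (balanced c))
                                                                       (subst₂ _<_ (sym (edge-yes u⟶w _)) (sym (edge-yes u⟶w _)) surplusᵘ) ⟩
      ∑[ c < n ] (edge c w * subtreeSum c (multiplicity xs))       ≤⟨ children≤subtreeSum w (multiplicity xs) ⟩
      subtreeSum w (multiplicity xs)                               ∎
      where open ≤-Reasoning

    occupiedPath-surplus : ∀ {u v} → OccupiedPath occ u v →
                           subtreeSum u (vacant occ) < subtreeSum u (multiplicity xs) →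
                           subtreeSum v (vacant occ) < subtreeSum v (multiplicity xs)
    occupiedPath-surplus (stuck _)         surplus = surplus
    occupiedPath-surplus (climb _ u⟶w path) surplus =
      occupiedPath-surplus path (surplus-up (occupiedPath-source path) u⟶w surplus)

  jammed-surplus : ∀ {occ s xs v} → Balanced occ (s ∷ xs) → OccupiedPath occ s v →
                   subtreeSum v (vacant occ) < subtreeSum v (multiplicity (s ∷ xs))
  jammed-surplus {occ} {s} {xs} balanced jam = occupiedPath-surplus {xs = s ∷ xs} balanced jam (begin-strict
    subtreeSum s (vacant occ)                                         ≡⟨ subtreeSum-occupied (occupiedPath-source jam) ⟩
    ∑[ c < n ] (edge c s * subtreeSum c (vacant occ))                 ≤⟨ children-balanced {xs = s ∷ xs} balanced s ⟩
    ∑[ c < n ] (edge c s * subtreeSum c (multiplicity (s ∷ xs)))      <⟨ +-monoˡ-< _ (≤-trans (≤-reflexive (sym (𝟙-yes (s ≟ᶠ s) refl))) (m≤m+n _ _)) ⟩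
    multiplicity (s ∷ xs) s + ∑[ c < n ] (edge c s * subtreeSum c (multiplicity (s ∷ xs)))
                                                                      ≡⟨ subtreeSum-decomposition s (multiplicity (s ∷ xs)) ⟨
    subtreeSum s (multiplicity (s ∷ xs))                              ∎)
    where open ≤-Reasoning

  park-or-jam : ∀ occ k s → iter (parent T) k (just s) ≡ nothing →
                (∃ λ w → ParksAt T occ s w) ⊎ (∃ λ r → OccupiedPath occ s r × parent T r ≡ nothing)
  park-or-jam occ zero    s ()
  park-or-jam occ (suc k) s halt with occ s in os
  ... | false = inj₁ (s , here os)
  ... | true  with parent T s in s⟶ | trans (sym (iter-suc (parent T) k s)) halt
  ...   | nothing | _     = inj₂ (s , stuck os , s⟶)
  ...   | just w  | haltʷ with park-or-jam occ k w haltʷ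
  ...     | inj₁ (v , pk)            = inj₁ (v , there os s⟶ pk)
  ...     | inj₂ (r , jam , r-root)  = inj₂ (r , climb os s⟶ jam , r-root)

  no-jam-at-root : ∀ {occ s xs r} → Balanced occ (s ∷ xs) → length (s ∷ xs) ≤ sum (vacant occ) →
                   OccupiedPath occ s r → parent T r ≢ nothing
  no-jam-at-root {occ} {s} {xs} {r} balanced enough jam r-root = <-irrefl refl (begin-strict
    sum (vacant occ)                          ≡⟨ subtreeSum-root (vacant occ) ⟨
    subtreeSum (root T) (vacant occ)          ≡⟨ cong (λ v → subtreeSum v (vacant occ)) (root-uniq T r r-root) ⟨
    subtreeSum r (vacant occ)                 <⟨ jammed-surplus {xs = xs} balanced jam ⟩
    subtreeSum r (multiplicity (s ∷ xs))      ≤⟨ subtreeSum≤∑ r (multiplicity (s ∷ xs)) ⟩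
    sum (multiplicity (s ∷ xs))               ≡⟨ ∑-multiplicity (s ∷ xs) ⟩
    length (s ∷ xs)                           ≤⟨ enough ⟩
    sum (vacant occ)                          ∎)
    where open ≤-Reasoning

  parksAt-passes : ∀ {occ s w v} → ParksAt T occ s w → s ⇝ v → ¬ w ⇝ v → OccupiedPath occ s v
  parksAt-passes (here _)          s⇝v                w⇝̸v = contradiction s⇝v w⇝̸v
  parksAt-passes (there os _ _)    ε                  _    = stuck os
  parksAt-passes (there os s⟶u pk) (s⟶x ◅ x⇝v) w⇝̸v with just-injective (trans (sym s⟶u) s⟶x)
  ... | refl = climb os s⟶u (parksAt-passes pk x⇝v w⇝̸v)

  balanced-after-parking : ∀ {occ s xs w} → Balanced occ (s ∷ xs) → ParksAt T occ s w →
                           Balanced (occupy occ w) xs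
  balanced-after-parking {occ} {s} {xs} {w} balanced pk v = settle (w ⇝? v) (s ⇝? v)
    where
      vacantᵛ driversᵛ : ℕ
      vacantᵛ  = subtreeSum v (vacant (occupy occ w))
      driversᵛ = subtreeSum v (multiplicity xs)

      split : (_R_ : ℕ → ℕ → Set) → subtreeSum v (vacant occ) R subtreeSum v (multiplicity (s ∷ xs)) →
              (member v w + vacantᵛ) R (member v s + driversᵛ)
      split _R_ = subst₂ _R_ (subtreeSum-occupy v (parksAt-vacant pk)) (subtreeSum-insert v s (multiplicity xs))

      settle : Dec (w ⇝ v) → Dec (s ⇝ v) → vacantᵛ ≤ driversᵛ
      settle (yes w⇝v) _         = ≤-pred (subst₂ _≤_ (cong (_+ vacantᵛ) (member-yes w⇝v))
                                     (cong (_+ driversᵛ) (member-yes (parksAt-path pk ◅◅ w⇝v))) (split _≤_ (balanced v)))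
      settle (no w⇝̸v) (yes s⇝v) = ≤-pred (subst₂ _<_ (cong (_+ vacantᵛ) (member-no w⇝̸v))
                                     (cong (_+ driversᵛ) (member-yes s⇝v))
                                     (split _<_ (jammed-surplus {xs = xs} balanced (parksAt-passes pk s⇝v w⇝̸v))))
      settle (no w⇝̸v) (no s⇝̸v) = subst₂ _≤_ (cong (_+ vacantᵛ) (member-no w⇝̸v))
                                     (cong (_+ driversᵛ) (member-no s⇝̸v)) (split _≤_ (balanced v))

  balanced⇒allPark : ∀ xs {occ} → Balanced occ xs → length xs ≤ sum (vacant occ) → AllPark T occ xs
  balanced⇒allPark []       _        _      = done
  balanced⇒allPark (s ∷ xs) {occ} balanced enough with park-or-jam occ (proj₁ (acyclic T s)) s (proj₂ (acyclic T s))
  ... | inj₂ (r , jam , r-root) = contradiction r-root (no-jam-at-root {xs = xs} balanced enough jam)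
  ... | inj₁ (w , pk)           = park pk (balanced⇒allPark xs (balanced-after-parking {xs = xs} balanced pk)
                                    (≤-pred (subst (length (s ∷ xs) ≤_) (∑-vacant-occupy {occ = occ} (parksAt-vacant pk)) enough)))

  subtree-bound⇒parking : ∀ (s : Vec (Fin n) n) → (∀ v → subtreeSize T v ≤ preferenceCount T s v) →
                          IsParkingFunction T s
  subtree-bound⇒parking s bound = balanced⇒allPark (toList s)
    (λ v → subst₂ _≤_ (subtreeSize≡subtreeSum v) (preferenceCount≡subtreeSum s v) (bound v))
    (≤-reflexive (trans (length-toList s) (sym (∑-ones n))))

proposition2p1 : (n : ℕ) (T : RootedTree n) (s : Vec (Fin n) n) →
    IsParkingFunction T s ⇔ (∀ (v : Fin n) → subtreeSize T v ≤ preferenceCount T s v)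
proposition2p1 n T s = mk⇔ (parking⇒subtree-bound T s) (subtree-bound⇒parking T s)
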